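{- Let $k\geq 2$ be an integer and, for $n\geq 0$, let $f_{k,n}$ denote the number of cyclic odd-up words over $k$ of length $n$. Let $F_k(x)=\sum_{n\geq 0}f_{k,n}x^n$. Then \[F_k(x)=1+x\left(\left\lfloor\frac{k+1}{2}\right\rfloor+\frac{\left\lfloor\frac{k+2}{2}\right\rfloor(x+1)^{\lfloor k/2\rfloor}-1}{x+2-(x+1)^{\lfloor (k+2)/2\rfloor}}\right).\]
   Context: For an integer $k\geq 2$, let $[k]=\{1,\ldots,k\}$. A word over $k$ of length $n$ is an element $w_1\cdots w_n\in[k]^n$. A word $w_1\cdots w_n$ with $n\geq 2$ is cyclic odd-up if for every $i\in[n]$, whenever $w_i$ is odd, $w_{i+1}>w_i$, where $w_{n+1}$ is defined to be $w_1$. By convention, the empty word (length $0$) and every word of length $1$ (i.e., each of the $k$ single letters) are counted as cyclic odd-up. -}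

module Defs where

open import Data.Nat as ℕ using (ℕ; zero; suc; _<_; _<?_; _%_; _/_)
import Data.Nat.Properties as ℕP
open import Data.Integer as ℤ using (ℤ; +_)
open import Data.Fin using (Fin; toℕ)
import Data.Fin
open import Data.Fin.Properties using (all?)
open import Data.Vec using (Vec; []; _∷_; lookup; _∷ʳ_; map)
open import Data.List as List using (List; [_]; concatMap; filter; length; upTo; allFin)
open import Data.Unit using (⊤; tt)
open import Relation.Binary.PropositionalEquality using (_≡_)
open import Relation.Nullary using (Dec; yes)
open import Relation.Nullary.Decidable using (_→-dec_)

-- Words over [k] = {1,…,k}.  A letter is represented by a : Fin k and
-- has value  suc (toℕ a) ∈ {1,…,k}.

letter : ∀ {k} → Fin k → ℕ
letter a = suc (toℕ a)

value : ∀ {k n} → Vec (Fin k) n → Vec ℕ n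
value = map letter

allWords : (k n : ℕ) → List (Vec (Fin k) n)
allWords k zero    = [ [] ]
allWords k (suc n) = concatMap (λ a → List.map (a ∷_) (allWords k n)) (allFin k)

Odd : ℕ → Set
Odd m = m % 2 ≡ 1

-- The cyclic successor of
-- position i is read off the extended word  w ∷ʳ w_1.
-- Length 0 and 1 words are cyclic odd-up by convention.
CyclicOddUp : ∀ {n} → Vec ℕ n → Set
CyclicOddUp []                 = ⊤
CyclicOddUp (x ∷ [])           = ⊤
CyclicOddUp {n} w@(x ∷ y ∷ ys) =
  ∀ (i : Fin n) → Odd (lookup w i) → lookup w i < lookup (w ∷ʳ x) (Data.Fin.suc i)

cyclicOddUp? : ∀ {n} (w : Vec ℕ n) → Dec (CyclicOddUp w)
cyclicOddUp? []               = yes tt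
cyclicOddUp? (x ∷ [])         = yes tt
cyclicOddUp? w@(x ∷ y ∷ ys)   =
  all? (λ i → (lookup w i % 2 ℕ.≟ 1) →-dec (lookup w i <? lookup (w ∷ʳ x) (Data.Fin.suc i)))

f : (k n : ℕ) → ℕ
f k n = length (filter (λ w → cyclicOddUp? (value w)) (allWords k n))

Series : Set
Series = ℕ → ℤ

const : ℤ → Series
const c zero    = c
const c (suc _) = + 0

X : Series
X 1 = + 1
X _ = + 0

infixl 6 _⊕_ _⊖_
infixl 7 _⊛_
infixr 8 _^ₛ_

_⊕_ : Series → Series → Series
(F ⊕ G) n = F n ℤ.+ G n

_⊖_ : Series → Series → Series
(F ⊖ G) n = F n ℤ.- G n

_⊛_ : Series → Series → Series
(F ⊛ G) n = List.foldr ℤ._+_ (+ 0) (List.map (λ j → F j ℤ.* G (n ℕ.∸ j)) (upTo (suc n)))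

_^ₛ_ : Series → ℕ → Series
F ^ₛ zero  = const (+ 1)
F ^ₛ suc m = F ⊛ (F ^ₛ m)

Fk : ℕ → Series
Fk k n = + (f k n)

module Submission where

-- Let M be the k × k transfer matrix M p y = [p odd ⇒ p < y]. A word of length
-- n ≥ 2 is cyclic odd-up iff M allows each of its cyclically consecutive pairs,
-- so f_{k,n} = tr Mⁿ. Write M = u 1ᵀ + N, where u marks the b = ⌊k/2⌋ even
-- letters and N p y = [p odd, p < y] is strictly upper triangular. Expanding
-- M^(m+1) in u 1ᵀ and N, every term except N^(m+1) (whose trace is 0) contains
-- a factor u 1ᵀ, and cutting the trace at the first such factor gives
--   tr M^(m+1) = Σ_s (s+1) g_s e_(m-s),   g_s = 1ᵀ Nˢ u,   Σ_m e_m xᵐ = 1/(1 - G),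
-- where G(x) = Σ_s g_s x^(s+1) counts the blocks odd < ⋯ < odd < even.
-- Hence F_k = 1 + ⌈k/2⌉ x + x G′/(1 - G). The hockey-stick identity evaluates
-- 1ᵀ Nˢ, giving G = (1+x)^(b+1) - 1 - x, that is 1 - G = x + 2 - (1+x)^(b+1).

open import Defs
open import Data.Bool.Base using (true; false; if_then_else_)
open import Data.Fin.Base using (Fin; zero; suc; toℕ; inject₁; fromℕ; opposite)
open import Data.Fin.Properties using (toℕ-inject₁; toℕ-fromℕ; opposite-prop; toℕ≤pred[n])
import Data.Fin.Permutation as Perm
open import Data.List.Base as List using (List; []; _∷_; concatMap; filter; length; tabulate; allFin)
open import Data.List.Properties using (map-++; map-cong; map-∘; map-tabulate)
open import Data.Nat.Base hiding (_^_)
open import Data.Nat.Combinatorics using (_C_; nC1≡n; nCk+nC[k+1]≡[n+1]C[k+1])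
open import Data.Nat.DivMod using (m/n≡1+[m∸n]/n)
open import Data.Nat.ListAction using () renaming (sum to listSum)
open import Data.Nat.ListAction.Properties using (sum-++)
open import Data.Nat.Properties
open import Data.Sum.Base using (inj₁; inj₂)
open import Data.Vec.Base using (Vec; []; _∷_; _∷ʳ_)
open import Data.Vec.Relation.Binary.Pointwise.Inductive as Pointwise using (Pointwise)
import Data.Vec.Relation.Binary.Pointwise.Extensional as Extensional
open import Function.Base using (_∘_; id)
open import Function.Bundles using (_⇔_; mk⇔)
open import Relation.Binary.PropositionalEquality
open import Relation.Nullary using (Dec; yes; no; does; ¬_; ¬?; _×-dec_; _→-dec_; contradiction)
open import Relation.Nullary.Decidable using (dec-false; does-⇔)
open import Relation.Unary using (Pred; Decidable)

import Algebra.Properties.CommutativeMonoid.Sum as CommutativeMonoidSum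
import Algebra.Properties.CommutativeSemigroup as CommutativeSemigroupProperties
import Algebra.Properties.Semiring.Sum as SemiringSum

open CommutativeMonoidSum +-0-commutativeMonoid
  using (sum; sum-syntax; sum⁺-syntax; sum-cong-≗; ∑-distrib-+; ∑-comm; sum-init-last; sum-replicate-zero)
open SemiringSum +-*-semiring using (*-distribˡ-sum; *-distribʳ-sum)
open CommutativeSemigroupProperties *-commutativeSemigroup using (x∙yz≈y∙xz)
open CommutativeSemigroupProperties +-commutativeSemigroup using () renaming (xy∙z≈xz∙y to +-xy∙z≈xz∙y)

-- Indicators and binomial sums

𝟙 : ∀ {p} {P : Set p} → Dec P → ℕ
𝟙 P? = if does P? then 1 else 0

𝟙-×-dec : ∀ {p q} {P : Set p} {Q : Set q} (P? : Dec P) (Q? : Dec Q) → 𝟙 (P? ×-dec Q?) ≡ 𝟙 P? * 𝟙 Q?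
𝟙-×-dec P? Q? with does P?
... | true  = sym (+-identityʳ (𝟙 Q?))
... | false = refl

¬⇒𝟙≡0 : ∀ {p} {P : Set p} (P? : Dec P) → ¬ P → 𝟙 P? ≡ 0
¬⇒𝟙≡0 P? ¬p = cong (if_then 1 else 0) (dec-false P? ¬p)

𝟙-⇔ : ∀ {p q} {P : Set p} {Q : Set q} → P ⇔ Q → (P? : Dec P) (Q? : Dec Q) → 𝟙 P? ≡ 𝟙 Q?
𝟙-⇔ P⇔Q P? Q? = cong (if_then 1 else 0) (does-⇔ P⇔Q P? Q?)

*-𝟙-cong : ∀ {p} {P : Set p} (P? : Dec P) {x y} → (P → x ≡ y) → x * 𝟙 P? ≡ y * 𝟙 P?
*-𝟙-cong (yes p) x≡y = cong (_* 1) (x≡y p)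
*-𝟙-cong (no _)  {x} {y} _ = trans (*-zeroʳ x) (sym (*-zeroʳ y))

∑-last : ∀ n (h : ℕ → ℕ) → ∑[ i ≤ n ] h (toℕ i) ≡ ∑[ i < n ] h (toℕ i) + h n
∑-last n h = begin
  ∑[ i ≤ n ] h (toℕ i)
    ≡⟨ sum-init-last (h ∘ toℕ) ⟩
  ∑[ i < n ] h (toℕ (inject₁ i)) + h (toℕ (fromℕ n))
    ≡⟨ cong₂ _+_ (sum-cong-≗ {n} (cong h ∘ toℕ-inject₁)) (cong h (toℕ-fromℕ n)) ⟩
  ∑[ i < n ] h (toℕ i) + h n
    ∎
  where open ≡-Reasoning

∑-restrict-< : ∀ {n} (h : ℕ → ℕ) (q : Fin n) → ∑[ p < n ] (h (toℕ p) * 𝟙 (toℕ p <? toℕ q)) ≡ ∑[ p < toℕ q ] h (toℕ p)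
∑-restrict-< {suc n} h zero    = trans (sum-cong-≗ {suc n} (λ p → *-zeroʳ (h (toℕ p)))) (sum-replicate-zero (suc n))
∑-restrict-< {suc n} h (suc q) = cong₂ _+_ (*-identityʳ (h 0)) (∑-restrict-< (h ∘ suc) q)

count : ∀ {p} {P : Pred ℕ p} → Decidable P → ℕ → ℕ
count P? n = ∑[ i < n ] 𝟙 (P? (toℕ i))

pascal-𝟙 : ∀ {p} {P : Set p} (P? : Dec P) c a → c C suc a + (c C a) * 𝟙 P? ≡ (c + 𝟙 P?) C suc a
pascal-𝟙 P? c a with does P?
... | true  = begin
  c C suc a + (c C a) * 1  ≡⟨ cong ((c C suc a) +_) (*-identityʳ (c C a)) ⟩
  c C suc a + c C a        ≡⟨ +-comm (c C suc a) (c C a) ⟩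
  c C a + c C suc a        ≡⟨ nCk+nC[k+1]≡[n+1]C[k+1] c a ⟩
  suc c C suc a            ≡⟨ cong (_C suc a) (+-comm 1 c) ⟩
  (c + 1) C suc a          ∎
  where open ≡-Reasoning
... | false = begin
  c C suc a + (c C a) * 0  ≡⟨ cong ((c C suc a) +_) (*-zeroʳ (c C a)) ⟩
  c C suc a + 0            ≡⟨ +-identityʳ (c C suc a) ⟩
  c C suc a                ≡⟨ cong (_C suc a) (+-identityʳ c) ⟨
  (c + 0) C suc a          ∎
  where open ≡-Reasoning

hockey-stick : ∀ {p} {P : Pred ℕ p} (P? : Decidable P) r a n →
               ∑[ i < n ] (((r + count P? (toℕ i)) C a) * 𝟙 (P? (toℕ i))) + r C suc a ≡ (r + count P? n) C suc a
hockey-stick P? r a zero    = cong (_C suc a) (sym (+-identityʳ r))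
hockey-stick P? r a (suc n) = begin
  ∑[ i ≤ n ] T (toℕ i) + r C suc a              ≡⟨ cong (_+ r C suc a) (∑-last n T) ⟩
  ∑[ i < n ] T (toℕ i) + T n + r C suc a        ≡⟨ +-xy∙z≈xz∙y (∑[ i < n ] T (toℕ i)) (T n) (r C suc a) ⟩
  ∑[ i < n ] T (toℕ i) + r C suc a + T n        ≡⟨ cong (_+ T n) (hockey-stick P? r a n) ⟩
  (r + count P? n) C suc a + T n                ≡⟨ pascal-𝟙 (P? n) (r + count P? n) a ⟩
  (r + count P? n + 𝟙 (P? n)) C suc a           ≡⟨ cong (_C suc a) (+-assoc r (count P? n) (𝟙 (P? n))) ⟩
  (r + (count P? n + 𝟙 (P? n))) C suc a         ≡⟨ cong (λ c → (r + c) C suc a) (∑-last n (𝟙 ∘ P?)) ⟨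
  (r + count P? (suc n)) C suc a                ∎
  where
  open ≡-Reasoning
  T : ℕ → ℕ
  T i = ((r + count P? i) C a) * 𝟙 (P? i)

[1+k]*[1+n]C[1+k]≡[1+n]*nCk : ∀ n k → suc k * (suc n C suc k) ≡ suc n * (n C k)
[1+k]*[1+n]C[1+k]≡[1+n]*nCk zero    zero    = refl
[1+k]*[1+n]C[1+k]≡[1+n]*nCk zero    (suc k) = *-zeroʳ (suc (suc k))
[1+k]*[1+n]C[1+k]≡[1+n]*nCk (suc n) zero    = begin
  1 * (suc (suc n) C 1)     ≡⟨ *-identityˡ _ ⟩
  suc (suc n) C 1           ≡⟨ nC1≡n (suc (suc n)) ⟩
  suc (suc n)               ≡⟨ *-identityʳ (suc (suc n)) ⟨
  suc (suc n) * 1           ∎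
  where open ≡-Reasoning
[1+k]*[1+n]C[1+k]≡[1+n]*nCk (suc n) (suc k) = begin
  suc (suc k) * (suc (suc n) C suc (suc k))
    ≡⟨ cong (suc (suc k) *_) (nCk+nC[k+1]≡[n+1]C[k+1] (suc n) (suc k)) ⟨
  suc (suc k) * (suc n C suc k + suc n C suc (suc k))
    ≡⟨ *-distribˡ-+ (suc (suc k)) (suc n C suc k) _ ⟩
  suc n C suc k + suc k * (suc n C suc k) + suc (suc k) * (suc n C suc (suc k))
    ≡⟨ cong₂ (λ x y → suc n C suc k + x + y) ([1+k]*[1+n]C[1+k]≡[1+n]*nCk n k) ([1+k]*[1+n]C[1+k]≡[1+n]*nCk n (suc k)) ⟩
  suc n C suc k + suc n * (n C k) + suc n * (n C suc k)
    ≡⟨ +-assoc (suc n C suc k) _ _ ⟩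
  suc n C suc k + (suc n * (n C k) + suc n * (n C suc k))
    ≡⟨ cong ((suc n C suc k) +_) (*-distribˡ-+ (suc n) (n C k) (n C suc k)) ⟨
  suc n C suc k + suc n * (n C k + n C suc k)
    ≡⟨ cong (λ x → suc n C suc k + suc n * x) (nCk+nC[k+1]≡[n+1]C[k+1] n k) ⟩
  suc (suc n) * (suc n C suc k)
    ∎
  where open ≡-Reasoning

-- Matrices acting on vectors

module _ {k : ℕ} where

  Vector : Set
  Vector = Fin k → ℕ

  Matrix : Set
  Matrix = Fin k → Fin k → ℕ

  infixr 5 _▷_
  infixl 5 _◁_
  infix  8 _^_

  _▷_ : Matrix → Vector → Vector
  (A ▷ v) p = ∑[ y < k ] (A p y * v y)

  _◁_ : Vector → Matrix → Vector
  (r ◁ A) y = ∑[ p < k ] (r p * A p y)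

  _^_ : Matrix → ℕ → Vector → Vector
  (A ^ zero)  v = v
  (A ^ suc j) v = A ▷ (A ^ j) v

  column : Matrix → Fin k → Vector
  column A z p = A p z

  module _ (A : Matrix) where

    ▷-cong : ∀ {v w} → v ≗ w → A ▷ v ≗ A ▷ w
    ▷-cong v≗w p = sum-cong-≗ {k} (cong (A p _ *_) ∘ v≗w)

    ▷-+ : ∀ v w → A ▷ (λ q → v q + w q) ≗ λ p → (A ▷ v) p + (A ▷ w) p
    ▷-+ v w p = trans (sum-cong-≗ {k} (λ y → *-distribˡ-+ (A p y) (v y) (w y)))
                      (∑-distrib-+ (λ y → A p y * v y) (λ y → A p y * w y))

    ▷-* : ∀ c v → A ▷ (λ q → c * v q) ≗ λ p → c * (A ▷ v) p
    ▷-* c v p = trans (sum-cong-≗ {k} (λ y → x∙yz≈y∙xz (A p y) c (v y)))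
                      (sym (*-distribˡ-sum {k} c (λ y → A p y * v y)))

    ▷-∑ : ∀ (c : Vector) (V : Fin k → Vector) →
          A ▷ (λ q → ∑[ z < k ] (c z * V z q)) ≗ λ p → ∑[ z < k ] (c z * (A ▷ V z) p)
    ▷-∑ c V p = begin
      ∑[ y < k ] (A p y * ∑[ z < k ] (c z * V z y))
        ≡⟨ sum-cong-≗ {k} (λ y → *-distribˡ-sum {k} (A p y) (λ z → c z * V z y)) ⟩
      ∑[ y < k ] ∑[ z < k ] (A p y * (c z * V z y))
        ≡⟨ ∑-comm (λ y z → A p y * (c z * V z y)) ⟩
      ∑[ z < k ] ∑[ y < k ] (A p y * (c z * V z y))
        ≡⟨ sum-cong-≗ {k} (λ z → sum-cong-≗ {k} (λ y → x∙yz≈y∙xz (A p y) (c z) (V z y))) ⟩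
      ∑[ z < k ] ∑[ y < k ] (c z * (A p y * V z y))
        ≡⟨ sum-cong-≗ {k} (λ z → *-distribˡ-sum {k} (c z) (λ y → A p y * V z y)) ⟨
      ∑[ z < k ] (c z * (A ▷ V z) p)
        ∎
      where open ≡-Reasoning

    ◁-▷ : ∀ r v → ∑[ p < k ] (r p * (A ▷ v) p) ≡ ∑[ y < k ] ((r ◁ A) y * v y)
    ◁-▷ r v = begin
      ∑[ p < k ] (r p * ∑[ y < k ] (A p y * v y))
        ≡⟨ sum-cong-≗ {k} (λ p → *-distribˡ-sum {k} (r p) (λ y → A p y * v y)) ⟩
      ∑[ p < k ] ∑[ y < k ] (r p * (A p y * v y))
        ≡⟨ ∑-comm (λ p y → r p * (A p y * v y)) ⟩
      ∑[ y < k ] ∑[ p < k ] (r p * (A p y * v y))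
        ≡⟨ sum-cong-≗ {k} (λ y → sum-cong-≗ {k} (λ p → *-assoc (r p) (A p y) (v y))) ⟨
      ∑[ y < k ] ∑[ p < k ] (r p * A p y * v y)
        ≡⟨ sum-cong-≗ {k} (λ y → *-distribʳ-sum {k} (v y) (λ p → r p * A p y)) ⟨
      ∑[ y < k ] ((r ◁ A) y * v y)
        ∎
      where open ≡-Reasoning

    ^-cong : ∀ j {v w} → v ≗ w → (A ^ j) v ≗ (A ^ j) w
    ^-cong zero    v≗w = v≗w
    ^-cong (suc j) v≗w = ▷-cong (^-cong j v≗w)

    ^-+ : ∀ j v w → (A ^ j) (λ q → v q + w q) ≗ λ p → (A ^ j) v p + (A ^ j) w p
    ^-+ zero    v w p = refl
    ^-+ (suc j) v w p = trans (▷-cong (^-+ j v w) p) (▷-+ _ _ p)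

    ^-* : ∀ j c v → (A ^ j) (λ q → c * v q) ≗ λ p → c * (A ^ j) v p
    ^-* zero    c v p = refl
    ^-* (suc j) c v p = trans (▷-cong (^-* j c v) p) (▷-* c _ p)

    ^-∑ : ∀ j (c : Vector) (V : Fin k → Vector) →
          (A ^ j) (λ q → ∑[ z < k ] (c z * V z q)) ≗ λ p → ∑[ z < k ] (c z * (A ^ j) (V z) p)
    ^-∑ zero    c V p = refl
    ^-∑ (suc j) c V p = trans (▷-cong (^-∑ j c V) p) (▷-∑ c _ p)

    ^-suc : ∀ j v → (A ^ j) (A ▷ v) ≗ (A ^ suc j) v
    ^-suc zero    v p = refl
    ^-suc (suc j) v p = ▷-cong (^-suc j v) p

    columnSums : ℕ → Vector
    columnSums zero    q = 1
    columnSums (suc a) q = (columnSums a ◁ A) q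

    sum-^ : ∀ a v → sum ((A ^ a) v) ≡ ∑[ q < k ] (columnSums a q * v q)
    sum-^ zero    v = sum-cong-≗ {k} (λ q → sym (*-identityˡ (v q)))
    sum-^ (suc a) v = begin
      sum ((A ^ suc a) v)                        ≡⟨ sum-cong-≗ {k} (^-suc a v) ⟨
      sum ((A ^ a) (A ▷ v))                      ≡⟨ sum-^ a (A ▷ v) ⟩
      ∑[ p < k ] (columnSums a p * (A ▷ v) p)    ≡⟨ ◁-▷ (columnSums a) v ⟩
      ∑[ q < k ] (columnSums (suc a) q * v q)    ∎
      where open ≡-Reasoning

    ∑-columns : ∀ j w → ∑[ z < k ] (sum ((A ^ j) (column A z)) * w z) ≡ sum ((A ^ suc j) w)
    ∑-columns j w = begin
      ∑[ z < k ] (sum ((A ^ j) (column A z)) * w z)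
        ≡⟨ sum-cong-≗ {k} (λ z → *-comm (sum ((A ^ j) (column A z))) (w z)) ⟩
      ∑[ z < k ] (w z * sum ((A ^ j) (column A z)))
        ≡⟨ sum-cong-≗ {k} (λ z → *-distribˡ-sum {k} (w z) ((A ^ j) (column A z))) ⟩
      ∑[ z < k ] ∑[ x < k ] (w z * (A ^ j) (column A z) x)
        ≡⟨ ∑-comm (λ z x → w z * (A ^ j) (column A z) x) ⟩
      ∑[ x < k ] ∑[ z < k ] (w z * (A ^ j) (column A z) x)
        ≡⟨ sum-cong-≗ {k} (^-∑ j w (column A)) ⟨
      sum ((A ^ j) (λ q → ∑[ z < k ] (w z * A q z)))
        ≡⟨ sum-cong-≗ {k} (^-cong j (λ q → sum-cong-≗ {k} (λ z → *-comm (w z) (A q z)))) ⟩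
      sum ((A ^ j) (A ▷ w))
        ≡⟨ sum-cong-≗ {k} (^-suc j w) ⟩
      sum ((A ^ suc j) w)
        ∎
      where open ≡-Reasoning

-- Powers of a rank-one perturbation of a strictly upper triangular matrix

module RankOnePlusStrictlyUpper
  {k : ℕ} (M : Matrix {k}) (u : Vector) (N : Matrix)
  (M-split : ∀ p y → M p y ≡ u p + N p y)
  (N-strict : ∀ {p y} → toℕ y ≤ toℕ p → N p y ≡ 0)
  where

  -- In matrix notation g a = 1ᵀ Nᵃ u, mixedSum b a = 1ᵀ Mᵇ Nᵃ u,
  -- e (1 + b) = 1ᵀ Mᵇ u and mixedTrace i j = tr (Nⁱ Mʲ⁺¹).

  g : ℕ → ℕ
  g a = sum ((N ^ a) u)

  mixedSum : ℕ → ℕ → ℕ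
  mixedSum b a = sum ((M ^ b) ((N ^ a) u))

  e : ℕ → ℕ
  e zero    = 1
  e (suc b) = mixedSum b 0

  mixedTrace : ℕ → ℕ → ℕ
  mixedTrace i j = ∑[ z < k ] ((N ^ i) ((M ^ j) (column M z)) z)

  ^-M▷-split : ∀ (A : Matrix) j v → (A ^ j) (M ▷ v) ≗ λ p → sum v * (A ^ j) u p + (A ^ j) (N ▷ v) p
  ^-M▷-split A j v p = begin
    (A ^ j) (M ▷ v) p                                      ≡⟨ ^-cong A j M▷-split p ⟩
    (A ^ j) (λ q → sum v * u q + (N ▷ v) q) p              ≡⟨ ^-+ A j (λ q → sum v * u q) (N ▷ v) p ⟩
    (A ^ j) (λ q → sum v * u q) p + (A ^ j) (N ▷ v) p      ≡⟨ cong (_+ (A ^ j) (N ▷ v) p) (^-* A j (sum v) u p) ⟩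
    sum v * (A ^ j) u p + (A ^ j) (N ▷ v) p                ∎
    where
    open ≡-Reasoning
    M▷-split : M ▷ v ≗ λ q → sum v * u q + (N ▷ v) q
    M▷-split q = begin
      ∑[ y < k ] (M q y * v y)               ≡⟨ sum-cong-≗ {k} (λ y → cong (_* v y) (M-split q y)) ⟩
      ∑[ y < k ] ((u q + N q y) * v y)       ≡⟨ sum-cong-≗ {k} (λ y → *-distribʳ-+ (v y) (u q) (N q y)) ⟩
      ∑[ y < k ] (u q * v y + N q y * v y)   ≡⟨ ∑-distrib-+ (λ y → u q * v y) (λ y → N q y * v y) ⟩
      ∑[ y < k ] (u q * v y) + (N ▷ v) q     ≡⟨ cong (_+ (N ▷ v) q) (*-distribˡ-sum {k} (u q) v) ⟨
      u q * sum v + (N ▷ v) q                ≡⟨ cong (_+ (N ▷ v) q) (*-comm (u q) (sum v)) ⟩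
      sum v * u q + (N ▷ v) q                ∎

  N^-column-N-vanishes : ∀ i z p → toℕ z ≤ toℕ p → (N ^ i) (column N z) p ≡ 0
  N^-column-N-vanishes zero    z p z≤p = N-strict z≤p
  N^-column-N-vanishes (suc i) z p z≤p = trans (sum-cong-≗ {k} term-vanishes) (sum-replicate-zero k)
    where
    term-vanishes : ∀ y → N p y * (N ^ i) (column N z) y ≡ 0
    term-vanishes y with ≤-<-connex (toℕ y) (toℕ p)
    ... | inj₁ y≤p = cong (_* (N ^ i) (column N z) y) (N-strict y≤p)
    ... | inj₂ p<y = trans (cong (N p y *_) (N^-column-N-vanishes i z y (≤-trans z≤p (<⇒≤ p<y))))
                           (*-zeroʳ (N p y))

  mixedSum-suc : ∀ b a → mixedSum (suc b) a ≡ e (suc b) * g a + mixedSum b (suc a)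
  mixedSum-suc b a = begin
    sum ((M ^ suc b) ((N ^ a) u))
      ≡⟨ sum-cong-≗ {k} (^-suc M b ((N ^ a) u)) ⟨
    sum ((M ^ b) (M ▷ (N ^ a) u))
      ≡⟨ sum-cong-≗ {k} (^-M▷-split M b ((N ^ a) u)) ⟩
    ∑[ p < k ] (g a * (M ^ b) u p + (M ^ b) ((N ^ suc a) u) p)
      ≡⟨ ∑-distrib-+ (λ p → g a * (M ^ b) u p) ((M ^ b) ((N ^ suc a) u)) ⟩
    ∑[ p < k ] (g a * (M ^ b) u p) + mixedSum b (suc a)
      ≡⟨ cong (_+ mixedSum b (suc a)) (*-distribˡ-sum {k} (g a) ((M ^ b) u)) ⟨
    g a * e (suc b) + mixedSum b (suc a)
      ≡⟨ cong (_+ mixedSum b (suc a)) (*-comm (g a) (e (suc b))) ⟩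
    e (suc b) * g a + mixedSum b (suc a)
      ∎
    where open ≡-Reasoning

  mixedSum-closed : ∀ b a → mixedSum b a ≡ ∑[ l ≤ b ] (e (b ∸ toℕ l) * g (a + toℕ l))
  mixedSum-closed zero    a = sym (trans (+-identityʳ _) (trans (*-identityˡ _) (cong g (+-identityʳ a))))
  mixedSum-closed (suc b) a = begin
    mixedSum (suc b) a
      ≡⟨ mixedSum-suc b a ⟩
    e (suc b) * g a + mixedSum b (suc a)
      ≡⟨ cong₂ _+_ (cong (λ c → e (suc b) * g c) (sym (+-identityʳ a))) (mixedSum-closed b (suc a)) ⟩
    e (suc b) * g (a + 0) + ∑[ l ≤ b ] (e (b ∸ toℕ l) * g (suc a + toℕ l))
      ≡⟨ cong (e (suc b) * g (a + 0) +_)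
              (sum-cong-≗ {suc b} (λ l → cong (λ c → e (b ∸ toℕ l) * g c) (sym (+-suc a (toℕ l))))) ⟩
    ∑[ l ≤ suc b ] (e (suc b ∸ toℕ l) * g (a + toℕ l))
      ∎
    where open ≡-Reasoning

  e-renewal : ∀ m → e (suc m) ≡ ∑[ l ≤ m ] (e (m ∸ toℕ l) * g (toℕ l))
  e-renewal m = mixedSum-closed m 0

  mixedTrace-zero : ∀ i → mixedTrace i 0 ≡ g i
  mixedTrace-zero i = begin
    ∑[ z < k ] ((N ^ i) (column M z) z)
      ≡⟨ sum-cong-≗ {k} (λ z → ^-cong N i (λ p → M-split p z) z) ⟩
    ∑[ z < k ] ((N ^ i) (λ p → u p + N p z) z)
      ≡⟨ sum-cong-≗ {k} (λ z → ^-+ N i u (column N z) z) ⟩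
    ∑[ z < k ] ((N ^ i) u z + (N ^ i) (column N z) z)
      ≡⟨ ∑-distrib-+ ((N ^ i) u) (λ z → (N ^ i) (column N z) z) ⟩
    g i + ∑[ z < k ] ((N ^ i) (column N z) z)
      ≡⟨ cong (g i +_) (trans (sum-cong-≗ {k} (λ z → N^-column-N-vanishes i z z ≤-refl)) (sum-replicate-zero k)) ⟩
    g i + 0
      ≡⟨ +-identityʳ (g i) ⟩
    g i
      ∎
    where open ≡-Reasoning

  mixedTrace-suc : ∀ i j → mixedTrace i (suc j) ≡ mixedSum (suc j) i + mixedTrace (suc i) j
  mixedTrace-suc i j = begin
    ∑[ z < k ] ((N ^ i) (M ▷ Y z) z)
      ≡⟨ sum-cong-≗ {k} (λ z → ^-M▷-split N i (Y z) z) ⟩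
    ∑[ z < k ] (sum (Y z) * (N ^ i) u z + (N ^ i) (N ▷ Y z) z)
      ≡⟨ sum-cong-≗ {k} (λ z → cong (sum (Y z) * (N ^ i) u z +_) (^-suc N i (Y z) z)) ⟩
    ∑[ z < k ] (sum (Y z) * (N ^ i) u z + (N ^ suc i) (Y z) z)
      ≡⟨ ∑-distrib-+ (λ z → sum (Y z) * (N ^ i) u z) (λ z → (N ^ suc i) (Y z) z) ⟩
    ∑[ z < k ] (sum (Y z) * (N ^ i) u z) + mixedTrace (suc i) j
      ≡⟨ cong (_+ mixedTrace (suc i) j) (∑-columns M j ((N ^ i) u)) ⟩
    mixedSum (suc j) i + mixedTrace (suc i) j
      ∎
    where
    open ≡-Reasoning
    Y : Fin k → Vector
    Y z = (M ^ j) (column M z)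

  mixedTrace-closed : ∀ j i → mixedTrace i j ≡ ∑[ s ≤ j ] (suc (toℕ s) * (e (j ∸ toℕ s) * g (i + toℕ s)))
  mixedTrace-closed zero    i = begin
    mixedTrace i 0                 ≡⟨ mixedTrace-zero i ⟩
    g i                            ≡⟨ cong g (+-identityʳ i) ⟨
    g (i + 0)                      ≡⟨ *-identityˡ (g (i + 0)) ⟨
    1 * g (i + 0)                  ≡⟨ *-identityˡ (1 * g (i + 0)) ⟨
    1 * (1 * g (i + 0))            ≡⟨ +-identityʳ _ ⟨
    1 * (1 * g (i + 0)) + 0        ∎
    where open ≡-Reasoning
  mixedTrace-closed (suc j) i = begin
    mixedTrace i (suc j)
      ≡⟨ mixedTrace-suc i j ⟩
    mixedSum (suc j) i + mixedTrace (suc i) j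
      ≡⟨ cong₂ _+_ (mixedSum-closed (suc j) i) (mixedTrace-closed j (suc i)) ⟩
    (first + ∑[ s ≤ j ] T s) + ∑[ s ≤ j ] (suc (toℕ s) * (e (j ∸ toℕ s) * g (suc i + toℕ s)))
      ≡⟨ cong ((first + ∑[ s ≤ j ] T s) +_)
              (sum-cong-≗ {suc j} (λ s → cong (λ c → suc (toℕ s) * (e (j ∸ toℕ s) * g c)) (sym (+-suc i (toℕ s))))) ⟩
    (first + ∑[ s ≤ j ] T s) + ∑[ s ≤ j ] (suc (toℕ s) * T s)
      ≡⟨ +-assoc first _ _ ⟩
    first + (∑[ s ≤ j ] T s + ∑[ s ≤ j ] (suc (toℕ s) * T s))
      ≡⟨ cong₂ _+_ (*-identityˡ first) (∑-distrib-+ T (λ s → suc (toℕ s) * T s)) ⟨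
    1 * first + ∑[ s ≤ j ] (suc (suc (toℕ s)) * T s)
      ∎
    where
    open ≡-Reasoning
    first : ℕ
    first = e (suc j) * g (i + 0)
    T : Fin (suc j) → ℕ
    T s = e (j ∸ toℕ s) * g (i + suc (toℕ s))

  trace-formula : ∀ m → ∑[ z < k ] ((M ^ m) (column M z) z) ≡ ∑[ s ≤ m ] (suc (toℕ s) * (e (m ∸ toℕ s) * g (toℕ s)))
  trace-formula m = mixedTrace-closed m 0

-- The transfer matrix of the odd-up condition

OddUp : ℕ → ℕ → Set
OddUp m n = Odd m → m < n

odd? : Decidable Odd
odd? m = m % 2 ≟ 1

oddUp? : ∀ m n → Dec (OddUp m n)
oddUp? m n = odd? m →-dec m <? n

oddLetter? : Decidable (Odd ∘ suc)
oddLetter? t = odd? (suc t)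

evenLetter? : Decidable (¬_ ∘ Odd ∘ suc)
evenLetter? t = ¬? (oddLetter? t)

count-evenLetter : ∀ t → count evenLetter? t ≡ ⌊ t /2⌋
count-evenLetter zero          = refl
count-evenLetter (suc zero)    = refl
count-evenLetter (suc (suc t)) = cong suc (count-evenLetter t)

count-oddLetter-below-even : ∀ t → ¬ Odd (suc t) → count oddLetter? t ≡ suc (count evenLetter? t)
count-oddLetter-below-even zero          even = contradiction refl even
count-oddLetter-below-even (suc zero)    even = refl
count-oddLetter-below-even (suc (suc t)) even = cong suc (count-oddLetter-below-even t even)

cyclicOddUp⇔Pointwise : ∀ {n} x y (ys : Vec ℕ n) →
                        CyclicOddUp (x ∷ y ∷ ys) ⇔ Pointwise OddUp (x ∷ y ∷ ys) ((y ∷ ys) ∷ʳ x)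
cyclicOddUp⇔Pointwise x y ys = mk⇔ (Extensional.extensional⇒inductive ∘ Extensional.ext)
                                   (Extensional.Pointwise.app ∘ Extensional.inductive⇒extensional)

length-filter≡listSum-𝟙 : ∀ {a p} {A : Set a} {P : Pred A p} (P? : Decidable P) xs →
                         length (filter P? xs) ≡ listSum (List.map (𝟙 ∘ P?) xs)
length-filter≡listSum-𝟙 P? []       = refl
length-filter≡listSum-𝟙 P? (x ∷ xs) with does (P? x)
... | true  = cong suc (length-filter≡listSum-𝟙 P? xs)
... | false = length-filter≡listSum-𝟙 P? xs

listSum-map-concatMap : ∀ {a b} {A : Set a} {B : Set b} (φ : B → ℕ) (h : A → List B) xs →
                        listSum (List.map φ (concatMap h xs)) ≡ listSum (List.map (listSum ∘ List.map φ ∘ h) xs)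
listSum-map-concatMap φ h []       = refl
listSum-map-concatMap φ h (x ∷ xs) = begin
  listSum (List.map φ (h x List.++ concatMap h xs))
    ≡⟨ cong listSum (map-++ φ (h x) (concatMap h xs)) ⟩
  listSum (List.map φ (h x) List.++ List.map φ (concatMap h xs))
    ≡⟨ sum-++ (List.map φ (h x)) _ ⟩
  listSum (List.map φ (h x)) + listSum (List.map φ (concatMap h xs))
    ≡⟨ cong (listSum (List.map φ (h x)) +_) (listSum-map-concatMap φ h xs) ⟩
  listSum (List.map (listSum ∘ List.map φ ∘ h) (x ∷ xs))
    ∎
  where open ≡-Reasoning

listSum-tabulate : ∀ {n} (t : Fin n → ℕ) → listSum (tabulate t) ≡ sum t
listSum-tabulate {zero}  t = refl
listSum-tabulate {suc n} t = cong (t zero +_) (listSum-tabulate (t ∘ suc))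

module _ {k : ℕ} where

  oddUpMatrix : Matrix {k}
  oddUpMatrix p y = 𝟙 (oddUp? (letter p) (letter y))

  evenLetter : Vector {k}
  evenLetter p = 𝟙 (evenLetter? (toℕ p))

  oddAscent : Matrix {k}
  oddAscent p y = 𝟙 (oddLetter? (toℕ p) ×-dec letter p <? letter y)

  oddUpMatrix-split : ∀ p y → oddUpMatrix p y ≡ evenLetter p + oddAscent p y
  oddUpMatrix-split p y with does (oddLetter? (toℕ p))
  ... | true  = refl
  ... | false = refl

  oddAscent-strict : ∀ {p y} → toℕ y ≤ toℕ p → oddAscent p y ≡ 0
  oddAscent-strict {p} {y} y≤p = begin
    oddAscent p y
      ≡⟨ 𝟙-×-dec (oddLetter? (toℕ p)) (letter p <? letter y) ⟩
    𝟙 (oddLetter? (toℕ p)) * 𝟙 (letter p <? letter y)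
      ≡⟨ cong (𝟙 (oddLetter? (toℕ p)) *_) (¬⇒𝟙≡0 (letter p <? letter y) (≤⇒≯ (s≤s y≤p))) ⟩
    𝟙 (oddLetter? (toℕ p)) * 0
      ≡⟨ *-zeroʳ (𝟙 (oddLetter? (toℕ p))) ⟩
    0
      ∎
    where open ≡-Reasoning

  wordSum : ∀ n → (Vec (Fin k) n → ℕ) → ℕ
  wordSum zero    φ = φ []
  wordSum (suc n) φ = ∑[ a < k ] wordSum n (φ ∘ (a ∷_))

  wordSum-cong : ∀ n {φ ψ} → φ ≗ ψ → wordSum n φ ≡ wordSum n ψ
  wordSum-cong zero    φ≗ψ = φ≗ψ []
  wordSum-cong (suc n) φ≗ψ = sum-cong-≗ {k} (λ a → wordSum-cong n (φ≗ψ ∘ (a ∷_)))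

  wordSum-* : ∀ n c φ → wordSum n (λ w → c * φ w) ≡ c * wordSum n φ
  wordSum-* zero    c φ = refl
  wordSum-* (suc n) c φ = begin
    ∑[ a < k ] wordSum n (λ w → c * φ (a ∷ w))    ≡⟨ sum-cong-≗ {k} (λ a → wordSum-* n c (φ ∘ (a ∷_))) ⟩
    ∑[ a < k ] (c * wordSum n (φ ∘ (a ∷_)))       ≡⟨ *-distribˡ-sum {k} c (λ a → wordSum n (φ ∘ (a ∷_))) ⟨
    c * wordSum (suc n) φ                         ∎
    where open ≡-Reasoning

  listSum-allWords : ∀ n φ → listSum (List.map φ (allWords k n)) ≡ wordSum n φ
  listSum-allWords zero    φ = +-identityʳ (φ [])
  listSum-allWords (suc n) φ = begin
    listSum (List.map φ (concatMap (λ a → List.map (a ∷_) (allWords k n)) (allFin k)))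
      ≡⟨ listSum-map-concatMap φ (λ a → List.map (a ∷_) (allWords k n)) (allFin k) ⟩
    listSum (List.map (λ a → listSum (List.map φ (List.map (a ∷_) (allWords k n)))) (allFin k))
      ≡⟨ cong listSum (map-cong (λ a → trans (cong listSum (sym (map-∘ (allWords k n))))
                                              (listSum-allWords n (φ ∘ (a ∷_))))
                                (allFin k)) ⟩
    listSum (List.map (λ a → wordSum n (φ ∘ (a ∷_))) (allFin k))
      ≡⟨ cong listSum (map-tabulate id (λ a → wordSum n (φ ∘ (a ∷_)))) ⟩
    listSum (tabulate (λ a → wordSum n (φ ∘ (a ∷_))))
      ≡⟨ listSum-tabulate (λ a → wordSum n (φ ∘ (a ∷_))) ⟩
    ∑[ a < k ] wordSum n (φ ∘ (a ∷_))
      ∎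
    where open ≡-Reasoning

  f≡wordSum : ∀ n → f k n ≡ wordSum n (λ w → 𝟙 (cyclicOddUp? (value w)))
  f≡wordSum n = trans (length-filter≡listSum-𝟙 (λ w → cyclicOddUp? (value w)) (allWords k n)) (listSum-allWords n _)

  chainWeight : ∀ {m} → Fin k → Vec (Fin k) m → Fin k → ℕ
  chainWeight p w z = 𝟙 (Pointwise.decidable oddUp? (letter p ∷ value w) (value w ∷ʳ letter z))

  chainWeight-∷ : ∀ {m} p a (w : Vec (Fin k) m) z → chainWeight p (a ∷ w) z ≡ oddUpMatrix p a * chainWeight a w z
  chainWeight-∷ p a w z =
    𝟙-×-dec (oddUp? (letter p) (letter a)) (Pointwise.decidable oddUp? (letter a ∷ value w) (value w ∷ʳ letter z))

  wordSum-chainWeight : ∀ m p z → wordSum m (λ w → chainWeight p w z) ≡ (oddUpMatrix ^ m) (column oddUpMatrix z) p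
  wordSum-chainWeight zero    p z =
    trans (𝟙-×-dec (oddUp? (letter p) (letter z)) (Pointwise.decidable oddUp? [] [])) (*-identityʳ (oddUpMatrix p z))
  wordSum-chainWeight (suc m) p z = begin
    ∑[ a < k ] wordSum m (λ w → chainWeight p (a ∷ w) z)
      ≡⟨ sum-cong-≗ {k} (λ a → wordSum-cong m (λ w → chainWeight-∷ p a w z)) ⟩
    ∑[ a < k ] wordSum m (λ w → oddUpMatrix p a * chainWeight a w z)
      ≡⟨ sum-cong-≗ {k} (λ a → wordSum-* m (oddUpMatrix p a) (λ w → chainWeight a w z)) ⟩
    ∑[ a < k ] (oddUpMatrix p a * wordSum m (λ w → chainWeight a w z))
      ≡⟨ sum-cong-≗ {k} (λ a → cong (oddUpMatrix p a *_) (wordSum-chainWeight m a z)) ⟩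
    (oddUpMatrix ^ suc m) (column oddUpMatrix z) p
      ∎
    where open ≡-Reasoning

  f-suc-suc : ∀ m → f k (suc (suc m)) ≡ ∑[ a < k ] ((oddUpMatrix ^ suc m) (column oddUpMatrix a) a)
  f-suc-suc m = begin
    f k (suc (suc m))
      ≡⟨ f≡wordSum (suc (suc m)) ⟩
    ∑[ a < k ] wordSum (suc m) (λ w → 𝟙 (cyclicOddUp? (value (a ∷ w))))
      ≡⟨ sum-cong-≗ {k} (λ a → wordSum-cong (suc m) (cyclic a)) ⟩
    ∑[ a < k ] wordSum (suc m) (λ w → chainWeight a w a)
      ≡⟨ sum-cong-≗ {k} (λ a → wordSum-chainWeight (suc m) a a) ⟩
    ∑[ a < k ] ((oddUpMatrix ^ suc m) (column oddUpMatrix a) a)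
      ∎
    where
    open ≡-Reasoning
    cyclic : ∀ a (w : Vec (Fin k) (suc m)) → 𝟙 (cyclicOddUp? (value (a ∷ w))) ≡ chainWeight a w a
    cyclic a (b ∷ w) = 𝟙-⇔ (cyclicOddUp⇔Pointwise (letter a) (letter b) (value w))
                           (cyclicOddUp? (value (a ∷ b ∷ w)))
                           (Pointwise.decidable oddUp? (value (a ∷ b ∷ w)) (value (b ∷ w) ∷ʳ letter a))

  f-one : f k 1 ≡ k
  f-one = trans (f≡wordSum 1) (∑-1 k)
    where
    ∑-1 : ∀ n → ∑[ i < n ] 1 ≡ n
    ∑-1 zero    = refl
    ∑-1 (suc n) = cong suc (∑-1 n)

  open RankOnePlusStrictlyUpper oddUpMatrix evenLetter oddAscent oddUpMatrix-split oddAscent-strict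

  columnSums-oddAscent : ∀ a q → columnSums oddAscent a q ≡ count oddLetter? (toℕ q) C a
  columnSums-oddAscent zero    q = refl
  columnSums-oddAscent (suc a) q = begin
    ∑[ p < k ] (columnSums oddAscent a p * oddAscent p q)
      ≡⟨ sum-cong-≗ {k} (λ p → cong₂ _*_ (columnSums-oddAscent a p)
                                         (𝟙-×-dec (oddLetter? (toℕ p)) (letter p <? letter q))) ⟩
    ∑[ p < k ] ((count oddLetter? (toℕ p) C a) * (𝟙 (oddLetter? (toℕ p)) * 𝟙 (toℕ p <? toℕ q)))
      ≡⟨ sum-cong-≗ {k} (λ p → *-assoc (count oddLetter? (toℕ p) C a) _ _) ⟨
    ∑[ p < k ] (T (toℕ p) * 𝟙 (toℕ p <? toℕ q))
      ≡⟨ ∑-restrict-< T q ⟩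
    ∑[ p < toℕ q ] T (toℕ p)
      ≡⟨ +-identityʳ _ ⟨
    ∑[ p < toℕ q ] T (toℕ p) + 0 C suc a
      ≡⟨ hockey-stick oddLetter? 0 a (toℕ q) ⟩
    count oddLetter? (toℕ q) C suc a
      ∎
    where
    open ≡-Reasoning
    T : ℕ → ℕ
    T t = (count oddLetter? t C a) * 𝟙 (oddLetter? t)

  g-closed : ∀ a → g a + 1 C suc a ≡ suc ⌊ k /2⌋ C suc a
  g-closed a = begin
    g a + 1 C suc a
      ≡⟨ cong (_+ 1 C suc a) (sum-^ oddAscent a evenLetter) ⟩
    ∑[ q < k ] (columnSums oddAscent a q * evenLetter q) + 1 C suc a
      ≡⟨ cong (_+ 1 C suc a) (sum-cong-≗ {k} term) ⟩
    ∑[ q < k ] (((1 + count evenLetter? (toℕ q)) C a) * 𝟙 (evenLetter? (toℕ q))) + 1 C suc a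
      ≡⟨ hockey-stick evenLetter? 1 a k ⟩
    suc (count evenLetter? k) C suc a
      ≡⟨ cong (λ c → suc c C suc a) (count-evenLetter k) ⟩
    suc ⌊ k /2⌋ C suc a
      ∎
    where
    open ≡-Reasoning
    term : ∀ q → columnSums oddAscent a q * evenLetter q
                 ≡ ((1 + count evenLetter? (toℕ q)) C a) * 𝟙 (evenLetter? (toℕ q))
    term q = trans (cong (_* evenLetter q) (columnSums-oddAscent a q))
                   (*-𝟙-cong (evenLetter? (toℕ q)) (cong (_C a) ∘ count-oddLetter-below-even (toℕ q)))

-- Formal power series

-- Imported only now: with ℤ's +_ in scope, ℕ sections such as (x +_) no longer parse.
open import Data.Integer.Base as ℤ using (ℤ; +_)
import Data.Integer.Properties as ℤP
open import Data.Integer.Tactic.RingSolver using (solve-∀)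

module ℤΣ where
  open CommutativeMonoidSum ℤP.+-0-commutativeMonoid public
  open SemiringSum ℤP.+-*-semiring public using (*-distribˡ-sum)

shift : Series → Series
shift F n = F (suc n)

pos-∑ : ∀ n (h : Fin n → ℕ) → + (∑[ i < n ] h i) ≡ ℤΣ.∑[ i < n ] (+ h i)
pos-∑ zero    h = refl
pos-∑ (suc n) h = trans (ℤP.pos-+ (h zero) _) (cong (ℤ._+_ (+ h zero)) (pos-∑ n (h ∘ suc)))

⊛-∑ : ∀ F G n → (F ⊛ G) n ≡ ℤΣ.∑[ j ≤ n ] (F (toℕ j) ℤ.* G (n ∸ toℕ j))
⊛-∑ F G n = foldr-applyUpTo id (suc n)
  where
  foldr-applyUpTo : ∀ (a : ℕ → ℕ) m →
    List.foldr ℤ._+_ (+ 0) (List.map (λ j → F j ℤ.* G (n ∸ j)) (List.applyUpTo a m))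
      ≡ ℤΣ.∑[ j < m ] (F (a (toℕ j)) ℤ.* G (n ∸ a (toℕ j)))
  foldr-applyUpTo a zero    = refl
  foldr-applyUpTo a (suc m) = cong (ℤ._+_ (F (a 0) ℤ.* G (n ∸ a 0))) (foldr-applyUpTo (a ∘ suc) m)

⊛-congˡ : ∀ {F F′} G → F ≗ F′ → F ⊛ G ≗ F′ ⊛ G
⊛-congˡ G F≗F′ n = cong (List.foldr ℤ._+_ (+ 0)) (map-cong (λ j → cong (ℤ._* G (n ∸ j)) (F≗F′ j)) (List.upTo (suc n)))

⊛-congʳ : ∀ F {G G′} → G ≗ G′ → F ⊛ G ≗ F ⊛ G′
⊛-congʳ F G≗G′ n = cong (List.foldr ℤ._+_ (+ 0)) (map-cong (λ j → cong (F j ℤ.*_) (G≗G′ (n ∸ j))) (List.upTo (suc n)))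

⊛-zero : ∀ F G → (F ⊛ G) 0 ≡ F 0 ℤ.* G 0
⊛-zero F G = ℤP.+-identityʳ (F 0 ℤ.* G 0)

⊛-suc : ∀ F G n → (F ⊛ G) (suc n) ≡ F 0 ℤ.* G (suc n) ℤ.+ (shift F ⊛ G) n
⊛-suc F G n = trans (⊛-∑ F G (suc n)) (cong (ℤ._+_ (F 0 ℤ.* G (suc n))) (sym (⊛-∑ (shift F) G n)))

⊛-distribʳ-⊕ : ∀ F G H → (F ⊕ G) ⊛ H ≗ F ⊛ H ⊕ G ⊛ H
⊛-distribʳ-⊕ F G H n = begin
  ((F ⊕ G) ⊛ H) n
    ≡⟨ ⊛-∑ (F ⊕ G) H n ⟩
  ℤΣ.∑[ j ≤ n ] ((F (toℕ j) ℤ.+ G (toℕ j)) ℤ.* H (n ∸ toℕ j))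
    ≡⟨ ℤΣ.sum-cong-≗ {suc n} (λ j → ℤP.*-distribʳ-+ (H (n ∸ toℕ j)) (F (toℕ j)) (G (toℕ j))) ⟩
  ℤΣ.∑[ j ≤ n ] (F (toℕ j) ℤ.* H (n ∸ toℕ j) ℤ.+ G (toℕ j) ℤ.* H (n ∸ toℕ j))
    ≡⟨ ℤΣ.∑-distrib-+ {suc n} (λ j → F (toℕ j) ℤ.* H (n ∸ toℕ j)) (λ j → G (toℕ j) ℤ.* H (n ∸ toℕ j)) ⟩
  ℤΣ.∑[ j ≤ n ] (F (toℕ j) ℤ.* H (n ∸ toℕ j)) ℤ.+ ℤΣ.∑[ j ≤ n ] (G (toℕ j) ℤ.* H (n ∸ toℕ j))
    ≡⟨ cong₂ ℤ._+_ (⊛-∑ F H n) (⊛-∑ G H n) ⟨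
  (F ⊛ H) n ℤ.+ (G ⊛ H) n
    ∎
  where open ≡-Reasoning

⊛-scaleˡ : ∀ c F G → (λ j → c ℤ.* F j) ⊛ G ≗ λ n → c ℤ.* (F ⊛ G) n
⊛-scaleˡ c F G n = begin
  ((λ j → c ℤ.* F j) ⊛ G) n
    ≡⟨ ⊛-∑ (λ j → c ℤ.* F j) G n ⟩
  ℤΣ.∑[ j ≤ n ] (c ℤ.* F (toℕ j) ℤ.* G (n ∸ toℕ j))
    ≡⟨ ℤΣ.sum-cong-≗ {suc n} (λ j → ℤP.*-assoc c (F (toℕ j)) (G (n ∸ toℕ j))) ⟩
  ℤΣ.∑[ j ≤ n ] (c ℤ.* (F (toℕ j) ℤ.* G (n ∸ toℕ j)))
    ≡⟨ ℤΣ.*-distribˡ-sum {suc n} c (λ j → F (toℕ j) ℤ.* G (n ∸ toℕ j)) ⟨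
  c ℤ.* ℤΣ.∑[ j ≤ n ] (F (toℕ j) ℤ.* G (n ∸ toℕ j))
    ≡⟨ cong (c ℤ.*_) (⊛-∑ F G n) ⟨
  c ℤ.* (F ⊛ G) n
    ∎
  where open ≡-Reasoning

⊛-distribʳ-⊖ : ∀ F G H → (F ⊖ G) ⊛ H ≗ F ⊛ H ⊖ G ⊛ H
⊛-distribʳ-⊖ F G H n = begin
  ((F ⊖ G) ⊛ H) n
    ≡⟨ ⊛-distribʳ-⊕ F (λ j → ℤ.- G j) H n ⟩
  (F ⊛ H) n ℤ.+ ((λ j → ℤ.- G j) ⊛ H) n
    ≡⟨ cong (ℤ._+_ ((F ⊛ H) n)) (⊛-congˡ H (λ j → sym (ℤP.-1*i≡-i (G j))) n) ⟩
  (F ⊛ H) n ℤ.+ ((λ j → ℤ.-1ℤ ℤ.* G j) ⊛ H) n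
    ≡⟨ cong (ℤ._+_ ((F ⊛ H) n)) (trans (⊛-scaleˡ ℤ.-1ℤ G H n) (ℤP.-1*i≡-i _)) ⟩
  (F ⊛ H) n ℤ.- (G ⊛ H) n
    ∎
  where open ≡-Reasoning

⊛-assoc : ∀ F G H → (F ⊛ G) ⊛ H ≗ F ⊛ (G ⊛ H)
⊛-assoc F G H zero    = begin
  ((F ⊛ G) ⊛ H) 0          ≡⟨ ⊛-zero (F ⊛ G) H ⟩
  (F ⊛ G) 0 ℤ.* H 0        ≡⟨ cong (ℤ._* H 0) (⊛-zero F G) ⟩
  F 0 ℤ.* G 0 ℤ.* H 0      ≡⟨ ℤP.*-assoc (F 0) (G 0) (H 0) ⟩
  F 0 ℤ.* (G 0 ℤ.* H 0)    ≡⟨ cong (F 0 ℤ.*_) (⊛-zero G H) ⟨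
  F 0 ℤ.* (G ⊛ H) 0        ≡⟨ ⊛-zero F (G ⊛ H) ⟨
  (F ⊛ (G ⊛ H)) 0          ∎
  where open ≡-Reasoning
⊛-assoc F G H (suc n) = begin
  ((F ⊛ G) ⊛ H) (suc n)
    ≡⟨ ⊛-suc (F ⊛ G) H n ⟩
  (F ⊛ G) 0 ℤ.* H (suc n) ℤ.+ (shift (F ⊛ G) ⊛ H) n
    ≡⟨ cong₂ ℤ._+_ (cong (ℤ._* H (suc n)) (⊛-zero F G)) (⊛-congˡ H (⊛-suc F G) n) ⟩
  F 0 ℤ.* G 0 ℤ.* H (suc n) ℤ.+ ((F₀·shift-G ⊕ shift F ⊛ G) ⊛ H) n
    ≡⟨ cong (ℤ._+_ (F 0 ℤ.* G 0 ℤ.* H (suc n))) (⊛-distribʳ-⊕ F₀·shift-G (shift F ⊛ G) H n) ⟩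
  F 0 ℤ.* G 0 ℤ.* H (suc n) ℤ.+ ((F₀·shift-G ⊛ H) n ℤ.+ ((shift F ⊛ G) ⊛ H) n)
    ≡⟨ cong (ℤ._+_ (F 0 ℤ.* G 0 ℤ.* H (suc n))) (cong₂ ℤ._+_ (⊛-scaleˡ (F 0) (shift G) H n) (⊛-assoc (shift F) G H n)) ⟩
  F 0 ℤ.* G 0 ℤ.* H (suc n) ℤ.+ (F 0 ℤ.* (shift G ⊛ H) n ℤ.+ (shift F ⊛ (G ⊛ H)) n)
    ≡⟨ regroup (F 0) (G 0) (H (suc n)) ((shift G ⊛ H) n) ((shift F ⊛ (G ⊛ H)) n) ⟩
  F 0 ℤ.* (G 0 ℤ.* H (suc n) ℤ.+ (shift G ⊛ H) n) ℤ.+ (shift F ⊛ (G ⊛ H)) n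
    ≡⟨ cong (λ t → F 0 ℤ.* t ℤ.+ (shift F ⊛ (G ⊛ H)) n) (⊛-suc G H n) ⟨
  F 0 ℤ.* (G ⊛ H) (suc n) ℤ.+ (shift F ⊛ (G ⊛ H)) n
    ≡⟨ ⊛-suc F (G ⊛ H) n ⟨
  (F ⊛ (G ⊛ H)) (suc n)
    ∎
  where
  open ≡-Reasoning
  F₀·shift-G : Series
  F₀·shift-G j = F 0 ℤ.* G (suc j)
  regroup : ∀ a b c d e → a ℤ.* b ℤ.* c ℤ.+ (a ℤ.* d ℤ.+ e) ≡ a ℤ.* (b ℤ.* c ℤ.+ d) ℤ.+ e
  regroup = solve-∀

⊛-comm : ∀ F G → F ⊛ G ≗ G ⊛ F
⊛-comm F G n = begin
  (F ⊛ G) n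
    ≡⟨ ⊛-∑ F G n ⟩
  ℤΣ.∑[ j ≤ n ] (F (toℕ j) ℤ.* G (n ∸ toℕ j))
    ≡⟨ ℤΣ.sum-permute (λ j → F (toℕ j) ℤ.* G (n ∸ toℕ j)) Perm.reverse ⟩
  ℤΣ.∑[ j ≤ n ] (F (toℕ (opposite j)) ℤ.* G (n ∸ toℕ (opposite j)))
    ≡⟨ ℤΣ.sum-cong-≗ {suc n} reversed ⟩
  ℤΣ.∑[ j ≤ n ] (G (toℕ j) ℤ.* F (n ∸ toℕ j))
    ≡⟨ ⊛-∑ G F n ⟨
  (G ⊛ F) n
    ∎
  where
  open ≡-Reasoning
  reversed : ∀ (j : Fin (suc n)) → F (toℕ (opposite j)) ℤ.* G (n ∸ toℕ (opposite j)) ≡ G (toℕ j) ℤ.* F (n ∸ toℕ j)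
  reversed j = begin
    F (toℕ (opposite j)) ℤ.* G (n ∸ toℕ (opposite j))
      ≡⟨ cong (λ i → F i ℤ.* G (n ∸ i)) (opposite-prop j) ⟩
    F (n ∸ toℕ j) ℤ.* G (n ∸ (n ∸ toℕ j))
      ≡⟨ cong (λ i → F (n ∸ toℕ j) ℤ.* G i) (m∸[m∸n]≡n (toℕ≤pred[n] j)) ⟩
    F (n ∸ toℕ j) ℤ.* G (toℕ j)
      ≡⟨ ℤP.*-comm (F (n ∸ toℕ j)) (G (toℕ j)) ⟩
    G (toℕ j) ℤ.* F (n ∸ toℕ j)
      ∎

const-⊛ : ∀ c F n → (const c ⊛ F) n ≡ c ℤ.* F n
const-⊛ c F zero    = ⊛-zero (const c) F
const-⊛ c F (suc n) = begin
  (const c ⊛ F) (suc n)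
    ≡⟨ ⊛-suc (const c) F n ⟩
  c ℤ.* F (suc n) ℤ.+ ((λ _ → + 0) ⊛ F) n
    ≡⟨ cong (ℤ._+_ (c ℤ.* F (suc n))) (trans (⊛-∑ (λ _ → + 0) F n) (ℤΣ.sum-replicate-zero (suc n))) ⟩
  c ℤ.* F (suc n) ℤ.+ + 0
    ≡⟨ ℤP.+-identityʳ (c ℤ.* F (suc n)) ⟩
  c ℤ.* F (suc n)
    ∎
  where open ≡-Reasoning

⊛-identityˡ : ∀ F → const (+ 1) ⊛ F ≗ F
⊛-identityˡ F n = trans (const-⊛ (+ 1) F n) (ℤP.*-identityˡ (F n))

⊛-identityʳ : ∀ F → F ⊛ const (+ 1) ≗ F
⊛-identityʳ F n = trans (⊛-comm F (const (+ 1)) n) (⊛-identityˡ F n)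

shift-X : shift X ≗ const (+ 1)
shift-X zero    = refl
shift-X (suc n) = refl

X-⊛-suc : ∀ F n → (X ⊛ F) (suc n) ≡ F n
X-⊛-suc F n = begin
  (X ⊛ F) (suc n)                        ≡⟨ ⊛-suc X F n ⟩
  + 0 ℤ.* F (suc n) ℤ.+ (shift X ⊛ F) n  ≡⟨ cong (ℤ._+ (shift X ⊛ F) n) (ℤP.*-zeroˡ (F (suc n))) ⟩
  + 0 ℤ.+ (shift X ⊛ F) n                ≡⟨ ℤP.+-identityˡ ((shift X ⊛ F) n) ⟩
  (shift X ⊛ F) n                        ≡⟨ ⊛-congˡ F shift-X n ⟩
  (const (+ 1) ⊛ F) n                    ≡⟨ ⊛-identityˡ F n ⟩
  F n                                    ∎
  where open ≡-Reasoning

shift-1+X : shift (X ⊕ const (+ 1)) ≗ const (+ 1)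
shift-1+X zero    = refl
shift-1+X (suc n) = refl

[1+X]^m-coefficient : ∀ m n → ((X ⊕ const (+ 1)) ^ₛ m) n ≡ + (m C n)
[1+X]^m-coefficient zero    zero    = refl
[1+X]^m-coefficient zero    (suc n) = refl
[1+X]^m-coefficient (suc m) zero    =
  trans (⊛-zero (X ⊕ const (+ 1)) ((X ⊕ const (+ 1)) ^ₛ m)) (trans (ℤP.*-identityˡ _) ([1+X]^m-coefficient m zero))
[1+X]^m-coefficient (suc m) (suc n) = begin
  ((X ⊕ const (+ 1)) ⊛ P^m) (suc n)
    ≡⟨ ⊛-suc (X ⊕ const (+ 1)) P^m n ⟩
  + 1 ℤ.* P^m (suc n) ℤ.+ (shift (X ⊕ const (+ 1)) ⊛ P^m) n
    ≡⟨ cong₂ ℤ._+_ (ℤP.*-identityˡ (P^m (suc n))) (⊛-congˡ P^m shift-1+X n) ⟩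
  P^m (suc n) ℤ.+ (const (+ 1) ⊛ P^m) n
    ≡⟨ cong₂ ℤ._+_ ([1+X]^m-coefficient m (suc n)) (trans (⊛-identityˡ P^m n) ([1+X]^m-coefficient m n)) ⟩
  + (m C suc n) ℤ.+ + (m C n)
    ≡⟨ ℤP.pos-+ (m C suc n) (m C n) ⟨
  + (m C suc n + m C n)
    ≡⟨ cong +_ (trans (+-comm (m C suc n) (m C n)) (nCk+nC[k+1]≡[n+1]C[k+1] m n)) ⟩
  + (suc m C suc n)
    ∎
  where
  open ≡-Reasoning
  P^m : Series
  P^m = (X ⊕ const (+ 1)) ^ₛ m

-- The generating function

module _ (k : ℕ) where

  open RankOnePlusStrictlyUpper (oddUpMatrix {k}) evenLetter oddAscent oddUpMatrix-split oddAscent-strict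

  𝔾 : Series
  𝔾 zero    = + 0
  𝔾 (suc a) = + g a

  x𝔾′ : Series
  x𝔾′ zero    = + 0
  x𝔾′ (suc a) = + (suc a * g a)

  𝔼 : Series
  𝔼 n = + e n

  𝔾⊛𝔼 : ∀ n → (𝔾 ⊛ 𝔼) n ≡ 𝔼 n ℤ.- const (+ 1) n
  𝔾⊛𝔼 zero    = refl
  𝔾⊛𝔼 (suc m) = begin
    (𝔾 ⊛ 𝔼) (suc m)                                      ≡⟨ ⊛-suc 𝔾 𝔼 m ⟩
    + 0 ℤ.* + e (suc m) ℤ.+ (shift 𝔾 ⊛ 𝔼) m              ≡⟨ ℤP.+-identityˡ _ ⟩
    (shift 𝔾 ⊛ 𝔼) m                                      ≡⟨ ⊛-∑ (shift 𝔾) 𝔼 m ⟩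
    ℤΣ.∑[ l ≤ m ] (+ g (toℕ l) ℤ.* + e (m ∸ toℕ l))      ≡⟨ ℤΣ.sum-cong-≗ {suc m} (pos-*-comm ∘ toℕ) ⟩
    ℤΣ.∑[ l ≤ m ] (+ (e (m ∸ toℕ l) * g (toℕ l)))        ≡⟨ pos-∑ (suc m) (λ l → e (m ∸ toℕ l) * g (toℕ l)) ⟨
    + (∑[ l ≤ m ] (e (m ∸ toℕ l) * g (toℕ l)))           ≡⟨ cong +_ (e-renewal m) ⟨
    + e (suc m)                                          ≡⟨ ℤP.+-identityʳ (+ e (suc m)) ⟨
    𝔼 (suc m) ℤ.- const (+ 1) (suc m)                    ∎
    where
    open ≡-Reasoning
    pos-*-comm : ∀ l → + g l ℤ.* + e (m ∸ l) ≡ + (e (m ∸ l) * g l)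
    pos-*-comm l = trans (sym (ℤP.pos-* (g l) (e (m ∸ l)))) (cong +_ (*-comm (g l) (e (m ∸ l))))

  𝔼⊛[1-𝔾] : 𝔼 ⊛ (const (+ 1) ⊖ 𝔾) ≗ const (+ 1)
  𝔼⊛[1-𝔾] n = begin
    (𝔼 ⊛ (const (+ 1) ⊖ 𝔾)) n                ≡⟨ ⊛-comm 𝔼 (const (+ 1) ⊖ 𝔾) n ⟩
    ((const (+ 1) ⊖ 𝔾) ⊛ 𝔼) n                ≡⟨ ⊛-distribʳ-⊖ (const (+ 1)) 𝔾 𝔼 n ⟩
    (const (+ 1) ⊛ 𝔼) n ℤ.- (𝔾 ⊛ 𝔼) n        ≡⟨ cong₂ ℤ._-_ (⊛-identityˡ 𝔼 n) (𝔾⊛𝔼 n) ⟩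
    𝔼 n ℤ.- (𝔼 n ℤ.- const (+ 1) n)          ≡⟨ x-[x-y]≡y (𝔼 n) (const (+ 1) n) ⟩
    const (+ 1) n                            ∎
    where
    open ≡-Reasoning
    x-[x-y]≡y : ∀ x y → x ℤ.- (x ℤ.- y) ≡ y
    x-[x-y]≡y = solve-∀

  x𝔾′⊛𝔼 : ∀ m → (x𝔾′ ⊛ 𝔼) (suc m) ≡ + ∑[ z < k ] ((oddUpMatrix ^ m) (column oddUpMatrix z) z)
  x𝔾′⊛𝔼 m = begin
    (x𝔾′ ⊛ 𝔼) (suc m)
      ≡⟨ ⊛-suc x𝔾′ 𝔼 m ⟩
    + 0 ℤ.* + e (suc m) ℤ.+ (shift x𝔾′ ⊛ 𝔼) m
      ≡⟨ ℤP.+-identityˡ _ ⟩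
    (shift x𝔾′ ⊛ 𝔼) m
      ≡⟨ ⊛-∑ (shift x𝔾′) 𝔼 m ⟩
    ℤΣ.∑[ s ≤ m ] (+ (suc (toℕ s) * g (toℕ s)) ℤ.* + e (m ∸ toℕ s))
      ≡⟨ ℤΣ.sum-cong-≗ {suc m} (pos-*-regroup ∘ toℕ) ⟩
    ℤΣ.∑[ s ≤ m ] (+ (suc (toℕ s) * (e (m ∸ toℕ s) * g (toℕ s))))
      ≡⟨ pos-∑ (suc m) (λ s → suc (toℕ s) * (e (m ∸ toℕ s) * g (toℕ s))) ⟨
    + ∑[ s ≤ m ] (suc (toℕ s) * (e (m ∸ toℕ s) * g (toℕ s)))
      ≡⟨ cong +_ (trace-formula m) ⟨
    + ∑[ z < k ] ((oddUpMatrix ^ m) (column oddUpMatrix z) z)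
      ∎
    where
    open ≡-Reasoning
    pos-*-regroup : ∀ s → + (suc s * g s) ℤ.* + e (m ∸ s) ≡ + (suc s * (e (m ∸ s) * g s))
    pos-*-regroup s = begin
      + (suc s * g s) ℤ.* + e (m ∸ s)    ≡⟨ ℤP.pos-* (suc s * g s) (e (m ∸ s)) ⟨
      + (suc s * g s * e (m ∸ s))        ≡⟨ cong +_ (*-assoc (suc s) (g s) (e (m ∸ s))) ⟩
      + (suc s * (g s * e (m ∸ s)))      ≡⟨ cong (λ t → + (suc s * t)) (*-comm (g s) (e (m ∸ s))) ⟩
      + (suc s * (e (m ∸ s) * g s))      ∎

  Fk≗1+⌈k/2⌉X+x𝔾′⊛𝔼 : Fk k ≗ (const (+ 1) ⊕ X ⊛ const (+ ⌈ k /2⌉)) ⊕ x𝔾′ ⊛ 𝔼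
  Fk≗1+⌈k/2⌉X+x𝔾′⊛𝔼 zero          = refl
  Fk≗1+⌈k/2⌉X+x𝔾′⊛𝔼 (suc zero)    = begin
    + f k 1
      ≡⟨ cong +_ (trans (f-one {k}) (sym (⌊n/2⌋+⌈n/2⌉≡n k))) ⟩
    + (⌊ k /2⌋ + ⌈ k /2⌉)
      ≡⟨ cong +_ (+-comm ⌊ k /2⌋ ⌈ k /2⌉) ⟩
    + (⌈ k /2⌉ + ⌊ k /2⌋)
      ≡⟨ ℤP.pos-+ ⌈ k /2⌉ ⌊ k /2⌋ ⟩
    + ⌈ k /2⌉ ℤ.+ + ⌊ k /2⌋
      ≡⟨ cong₂ ℤ._+_ (X-⊛-suc (const (+ ⌈ k /2⌉)) 0) trace-M ⟨
    (X ⊛ const (+ ⌈ k /2⌉)) 1 ℤ.+ (x𝔾′ ⊛ 𝔼) 1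
      ≡⟨ cong (ℤ._+ (x𝔾′ ⊛ 𝔼) 1) (ℤP.+-identityˡ ((X ⊛ const (+ ⌈ k /2⌉)) 1)) ⟨
    (+ 0 ℤ.+ (X ⊛ const (+ ⌈ k /2⌉)) 1) ℤ.+ (x𝔾′ ⊛ 𝔼) 1
      ∎
    where
    open ≡-Reasoning
    trace-M : (x𝔾′ ⊛ 𝔼) 1 ≡ + ⌊ k /2⌋
    trace-M = begin
      (x𝔾′ ⊛ 𝔼) 1
        ≡⟨ x𝔾′⊛𝔼 0 ⟩
      + ∑[ z < k ] oddUpMatrix z z
        ≡⟨ cong +_ (trace-formula 0) ⟩
      + (1 * (1 * g 0) + 0)
        ≡⟨ cong +_ (trans (+-identityʳ _) (trans (*-identityˡ _) (*-identityˡ (g 0)))) ⟩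
      + g 0
        ≡⟨ cong +_ (count-evenLetter k) ⟩
      + ⌊ k /2⌋
        ∎
  Fk≗1+⌈k/2⌉X+x𝔾′⊛𝔼 (suc (suc m)) = begin
    + f k (suc (suc m))
      ≡⟨ cong +_ (f-suc-suc {k} m) ⟩
    + ∑[ z < k ] ((oddUpMatrix ^ suc m) (column oddUpMatrix z) z)
      ≡⟨ x𝔾′⊛𝔼 (suc m) ⟨
    (x𝔾′ ⊛ 𝔼) (suc (suc m))
      ≡⟨ ℤP.+-identityˡ _ ⟨
    + 0 ℤ.+ (x𝔾′ ⊛ 𝔼) (suc (suc m))
      ≡⟨ cong (λ t → (+ 0 ℤ.+ t) ℤ.+ (x𝔾′ ⊛ 𝔼) (suc (suc m))) (X-⊛-suc (const (+ ⌈ k /2⌉)) (suc m)) ⟨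
    (+ 0 ℤ.+ (X ⊛ const (+ ⌈ k /2⌉)) (suc (suc m))) ℤ.+ (x𝔾′ ⊛ 𝔼) (suc (suc m))
      ∎
    where open ≡-Reasoning

  denominator≗1-𝔾 : X ⊕ const (+ 2) ⊖ (X ⊕ const (+ 1)) ^ₛ suc ⌊ k /2⌋ ≗ const (+ 1) ⊖ 𝔾
  denominator≗1-𝔾 zero    = cong (ℤ._-_ (+ 2)) ([1+X]^m-coefficient (suc ⌊ k /2⌋) 0)
  denominator≗1-𝔾 (suc a) = begin
    X (suc a) ℤ.+ + 0 ℤ.- ((X ⊕ const (+ 1)) ^ₛ suc ⌊ k /2⌋) (suc a)
      ≡⟨ cong₂ ℤ._-_ (trans (ℤP.+-identityʳ _) (X-suc a)) ([1+X]^m-coefficient (suc ⌊ k /2⌋) (suc a)) ⟩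
    + (1 C suc a) ℤ.- + (suc ⌊ k /2⌋ C suc a)
      ≡⟨ cong (λ c → + (1 C suc a) ℤ.- + c) (g-closed a) ⟨
    + (1 C suc a) ℤ.- + (g a + 1 C suc a)
      ≡⟨ cong (ℤ._-_ (+ (1 C suc a))) (ℤP.pos-+ (g a) (1 C suc a)) ⟩
    + (1 C suc a) ℤ.- (+ g a ℤ.+ + (1 C suc a))
      ≡⟨ y-[x+y]≡0-x (+ g a) (+ (1 C suc a)) ⟩
    + 0 ℤ.- + g a
      ∎
    where
    open ≡-Reasoning
    X-suc : ∀ a → X (suc a) ≡ + (1 C suc a)
    X-suc zero    = refl
    X-suc (suc a) = refl
    y-[x+y]≡0-x : ∀ x y → y ℤ.- (x ℤ.+ y) ≡ + 0 ℤ.- x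
    y-[x+y]≡0-x = solve-∀

  x𝔾′≗X⊛numerator : x𝔾′ ≗ X ⊛ (const (+ suc ⌊ k /2⌋) ⊛ (X ⊕ const (+ 1)) ^ₛ ⌊ k /2⌋ ⊖ const (+ 1))
  x𝔾′≗X⊛numerator zero    = sym (⊛-zero X Q)
    where
    Q : Series
    Q = const (+ suc ⌊ k /2⌋) ⊛ (X ⊕ const (+ 1)) ^ₛ ⌊ k /2⌋ ⊖ const (+ 1)
  x𝔾′≗X⊛numerator (suc m) = sym (begin
    (X ⊛ Q) (suc m)
      ≡⟨ X-⊛-suc Q m ⟩
    (const (+ suc ⌊ k /2⌋) ⊛ (X ⊕ const (+ 1)) ^ₛ ⌊ k /2⌋) m ℤ.- const (+ 1) m
      ≡⟨ cong₂ ℤ._-_ (const-⊛ (+ suc ⌊ k /2⌋) ((X ⊕ const (+ 1)) ^ₛ ⌊ k /2⌋) m) (const-1 m) ⟩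
    + suc ⌊ k /2⌋ ℤ.* ((X ⊕ const (+ 1)) ^ₛ ⌊ k /2⌋) m ℤ.- + (1 C suc m)
      ≡⟨ cong (λ c → + suc ⌊ k /2⌋ ℤ.* c ℤ.- + (1 C suc m)) ([1+X]^m-coefficient ⌊ k /2⌋ m) ⟩
    + suc ⌊ k /2⌋ ℤ.* + (⌊ k /2⌋ C m) ℤ.- + (1 C suc m)
      ≡⟨ cong (ℤ._- + (1 C suc m)) (ℤP.pos-* (suc ⌊ k /2⌋) (⌊ k /2⌋ C m)) ⟨
    + (suc ⌊ k /2⌋ * (⌊ k /2⌋ C m)) ℤ.- + (1 C suc m)
      ≡⟨ cong (λ c → + c ℤ.- + (1 C suc m)) coefficient ⟩
    + (suc m * g m + 1 C suc m) ℤ.- + (1 C suc m)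
      ≡⟨ cong (ℤ._- + (1 C suc m)) (ℤP.pos-+ (suc m * g m) (1 C suc m)) ⟩
    + (suc m * g m) ℤ.+ + (1 C suc m) ℤ.- + (1 C suc m)
      ≡⟨ [x+y]-y≡x (+ (suc m * g m)) (+ (1 C suc m)) ⟩
    + (suc m * g m)
      ∎)
    where
    open ≡-Reasoning
    Q : Series
    Q = const (+ suc ⌊ k /2⌋) ⊛ (X ⊕ const (+ 1)) ^ₛ ⌊ k /2⌋ ⊖ const (+ 1)
    const-1 : ∀ m → const (+ 1) m ≡ + (1 C suc m)
    const-1 zero    = refl
    const-1 (suc m) = refl
    [1+m]*1C[1+m]≡1C[1+m] : ∀ m → suc m * (1 C suc m) ≡ 1 C suc m
    [1+m]*1C[1+m]≡1C[1+m] zero    = refl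
    [1+m]*1C[1+m]≡1C[1+m] (suc m) = *-zeroʳ (suc (suc m))
    coefficient : suc ⌊ k /2⌋ * (⌊ k /2⌋ C m) ≡ suc m * g m + 1 C suc m
    coefficient = begin
      suc ⌊ k /2⌋ * (⌊ k /2⌋ C m)         ≡⟨ [1+k]*[1+n]C[1+k]≡[1+n]*nCk ⌊ k /2⌋ m ⟨
      suc m * (suc ⌊ k /2⌋ C suc m)       ≡⟨ cong (suc m *_) (g-closed m) ⟨
      suc m * (g m + 1 C suc m)           ≡⟨ *-distribˡ-+ (suc m) (g m) (1 C suc m) ⟩
      suc m * g m + suc m * (1 C suc m)   ≡⟨ cong (_+_ (suc m * g m)) ([1+m]*1C[1+m]≡1C[1+m] m) ⟩
      suc m * g m + 1 C suc m             ∎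
    [x+y]-y≡x : ∀ x y → x ℤ.+ y ℤ.- y ≡ x
    [x+y]-y≡x = solve-∀

  generating-function : ∀ n →
    (Fk k ⊛ (X ⊕ const (+ 2) ⊖ (X ⊕ const (+ 1)) ^ₛ suc ⌊ k /2⌋)) n
      ≡ ((const (+ 1) ⊕ X ⊛ const (+ ⌈ k /2⌉))
           ⊛ (X ⊕ const (+ 2) ⊖ (X ⊕ const (+ 1)) ^ₛ suc ⌊ k /2⌋)
         ⊕ X ⊛ (const (+ suc ⌊ k /2⌋) ⊛ (X ⊕ const (+ 1)) ^ₛ ⌊ k /2⌋ ⊖ const (+ 1))) n
  generating-function n = begin
    (Fk k ⊛ D) n                           ≡⟨ ⊛-congˡ D Fk≗1+⌈k/2⌉X+x𝔾′⊛𝔼 n ⟩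
    ((A ⊕ x𝔾′ ⊛ 𝔼) ⊛ D) n                  ≡⟨ ⊛-distribʳ-⊕ A (x𝔾′ ⊛ 𝔼) D n ⟩
    (A ⊛ D) n ℤ.+ ((x𝔾′ ⊛ 𝔼) ⊛ D) n        ≡⟨ cong (ℤ._+_ ((A ⊛ D) n)) (⊛-assoc x𝔾′ 𝔼 D n) ⟩
    (A ⊛ D) n ℤ.+ (x𝔾′ ⊛ (𝔼 ⊛ D)) n        ≡⟨ cong (ℤ._+_ ((A ⊛ D) n)) (⊛-congʳ x𝔾′ 𝔼⊛D≗1 n) ⟩
    (A ⊛ D) n ℤ.+ (x𝔾′ ⊛ const (+ 1)) n    ≡⟨ cong (ℤ._+_ ((A ⊛ D) n)) (trans (⊛-identityʳ x𝔾′ n) (x𝔾′≗X⊛numerator n)) ⟩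
    (A ⊛ D ⊕ X ⊛ Q) n                      ∎
    where
    open ≡-Reasoning
    A D Q : Series
    A = const (+ 1) ⊕ X ⊛ const (+ ⌈ k /2⌉)
    D = X ⊕ const (+ 2) ⊖ (X ⊕ const (+ 1)) ^ₛ suc ⌊ k /2⌋
    Q = const (+ suc ⌊ k /2⌋) ⊛ (X ⊕ const (+ 1)) ^ₛ ⌊ k /2⌋ ⊖ const (+ 1)
    𝔼⊛D≗1 : 𝔼 ⊛ D ≗ const (+ 1)
    𝔼⊛D≗1 j = trans (⊛-congʳ 𝔼 denominator≗1-𝔾 j) (𝔼⊛[1-𝔾] j)

n/2≡⌊n/2⌋ : ∀ n → n / 2 ≡ ⌊ n /2⌋
n/2≡⌊n/2⌋ zero          = refl
n/2≡⌊n/2⌋ (suc zero)    = refl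
n/2≡⌊n/2⌋ (suc (suc n)) = trans (m/n≡1+[m∸n]/n {suc (suc n)} (s≤s (s≤s z≤n))) (cong suc (n/2≡⌊n/2⌋ n))

theorem4 : (k : ℕ) → 2 ≤ k → (n : ℕ) →
    (Fk k ⊛ (X ⊕ const (+ 2) ⊖ (X ⊕ const (+ 1)) ^ₛ ((k + 2) / 2))) n
      ≡ ((const (+ 1) ⊕ X ⊛ const (+ ((k + 1) / 2)))
           ⊛ (X ⊕ const (+ 2) ⊖ (X ⊕ const (+ 1)) ^ₛ ((k + 2) / 2))
         ⊕ X ⊛ (const (+ ((k + 2) / 2)) ⊛ (X ⊕ const (+ 1)) ^ₛ (k / 2) ⊖ const (+ 1))) n
-- The identity holds for every k.
theorem4 k _ n
  rewrite trans (cong (_/ 2) (+-comm k 2)) (n/2≡⌊n/2⌋ (suc (suc k)))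
        | trans (cong (_/ 2) (+-comm k 1)) (n/2≡⌊n/2⌋ (suc k))
        | n/2≡⌊n/2⌋ k
  = generating-function k n
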